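{- Let $a,n\ge 1$ be integers. Let $T$ be a tree which is $2^{a-1}n$-good from a string $\alpha$, and let $P_1,\ldots,P_a\subseteq\omega^{<\omega}$ be sets of strings with $T\subseteq\bigcup_{i=1}^a P_i$. Then for some $i$, $T$ has a subset which is $n$-good from $\alpha$ for $P_i$.
   Context: Strings are elements of $\omega^{<\omega}$; $\sigma\subseteq\tau$ means $\tau$ extends $\sigma$, and $\sigma\subset\tau$ means proper extension; the immediate successors of $\tau$ are the strings $\tau * k$, $k\in\omega$. A tree is a finite set of pairwise incomparable strings. Given $a\in\omega$, a nonempty tree $T$ is $a$-good from $\sigma$ if (1) every $\tau\in T$ extends $\sigma$, and (2) for each string $\tau$ such that $\sigma\subseteq\tau\subset\rho$ for some $\rho\in T$, at least $a$ many immediate successors of $\tau$ are initial segments of elements of $T$. If in addition $T\subseteq P$, $T$ is called $a$-good from $\sigma$ for $P$. -}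

module Defs where

open import Data.Nat using (ℕ)
open import Data.Fin using (Fin)
open import Data.List using (List; []; _∷_; _++_; [_])
open import Data.List.Membership.Propositional using (_∈_)
open import Data.List.Relation.Unary.AllPairs using (AllPairs)
open import Data.Product using (Σ; ∃; ∃-syntax; _×_)
open import Function.Definitions using (Injective)
open import Relation.Binary.PropositionalEquality using (_≡_)
open import Relation.Nullary using (¬_)

Str : Set
Str = List ℕ

_⊑_ : Str → Str → Set
σ ⊑ τ = ∃[ ρ ] (σ ++ ρ ≡ τ)

_⊏_ : Str → Str → Set
σ ⊏ τ = σ ⊑ τ × ¬ (σ ≡ τ)

_*ˢ_ : Str → ℕ → Str
τ *ˢ k = τ ++ [ k ]

Incomparable : Str → Str → Set
Incomparable σ τ = ¬ (σ ⊑ τ) × ¬ (τ ⊑ σ)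

-- A tree: a finite set of pairwise incomparable strings, represented as a
-- list whose entries are pairwise incomparable (hence also distinct).
IsTree : List Str → Set
IsTree T = AllPairs Incomparable T

NonEmpty : List Str → Set
NonEmpty T = ∃[ τ ] (τ ∈ T)

IsInitSeg : List Str → Str → Set
IsInitSeg T τ = ∃[ ρ ] (ρ ∈ T × τ ⊑ ρ)

ManySuccs : ℕ → List Str → Str → Set
ManySuccs a T τ =
  Σ (Fin a → ℕ) λ f → Injective _≡_ _≡_ f × (∀ j → IsInitSeg T (τ *ˢ f j))

-- T is a-good from σ (T assumed to be a tree)
Good : ℕ → List Str → Str → Set
Good a T σ =
  NonEmpty T
  × (∀ τ → τ ∈ T → σ ⊑ τ)
  × (∀ τ → σ ⊑ τ → (∃[ ρ ] (ρ ∈ T × τ ⊏ ρ)) → ManySuccs a T τ)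

GoodFor : ℕ → List Str → Str → (Str → Set) → Set
GoodFor a T σ P = Good a T σ × (∀ τ → τ ∈ T → P τ)

module Submission where

-- The heart of the proof is the two-colour case (twoColours): a tree that is
-- 2m-good from α and coloured by A ⊎ B has a subtree that is m-good from α
-- and entirely A or entirely B.  It is proved bottom-up, by recursion on the
-- height of T above a node σ.  A leaf σ ∈ T is a one-element monochromatic
-- subtree.  An inner node has 2m children leading into T; each child carries a
-- monochromatic subtree, and by the pigeonhole principle m of them share a
-- colour, so their union is m-good from σ for that colour.  Subtrees are
-- decidable predicates, filtered out of T (hence trees) only at the end.

open import Defs
open import Data.Nat using (ℕ; _≤_; _^_; _*_; _∸_)
open import Data.Fin using (Fin)
open import Data.List using (List)
open import Data.List.Membership.Propositional using (_∈_)
open import Data.Product using (∃; ∃-syntax; _×_)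

open import Data.Bool using (Bool; true; false)
open import Data.Empty using (⊥-elim)
import Data.Fin as F
open import Data.Fin.Properties using (any?; suc-injective; inject≤-injective; lift-injective)
open import Data.List using ([]; _∷_; _++_; [_]; length; map; filter)
import Data.List.Properties as List
open import Data.List.Membership.Propositional.Properties using (∈-filter⁺; ∈-filter⁻)
open import Data.List.Relation.Unary.Any using (here; there)
open import Data.List.Relation.Unary.AllPairs.Properties using (filter⁺)
open import Data.Nat using (zero; suc; _+_; _<_; s≤s; z≤n)
import Data.Nat.Properties as ℕ
open import Data.Nat.ListAction using (sum)
open import Data.Product using (Σ; _,_; proj₁; proj₂)
open import Data.Sum using (_⊎_; inj₁; inj₂)
open import Function using (_∘_)
open import Function.Definitions using (Injective)
open import Relation.Nullary using (Dec; yes; no; ¬_)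
open import Relation.Binary.PropositionalEquality using (_≡_; refl; sym; trans; cong; subst)

_≟ˢ_ : (σ τ : Str) → Dec (σ ≡ τ)
_≟ˢ_ = List.≡-dec ℕ._≟_

⊑-refl : ∀ σ → σ ⊑ σ
⊑-refl σ = [] , List.++-identityʳ σ

⊑-child : ∀ σ k → σ ⊑ (σ *ˢ k)
⊑-child σ k = [ k ] , refl

⊑-trans : ∀ {σ τ ρ} → σ ⊑ τ → τ ⊑ ρ → σ ⊑ ρ
⊑-trans {σ} (x , refl) (y , refl) = x ++ y , sym (List.++-assoc σ x y)

⊑-length : ∀ {σ τ} → σ ⊑ τ → length σ ≤ length τ
⊑-length {σ} (_ , refl) = List.length-++-≤ˡ σ

⊑⇒≡⊎⊏ : ∀ {σ τ} → σ ⊑ τ → σ ≡ τ ⊎ σ ⊏ τ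
⊑⇒≡⊎⊏ {σ} {τ} σ⊑τ with σ ≟ˢ τ
... | yes σ≡τ = inj₁ σ≡τ
... | no σ≢τ = inj₂ (σ⊑τ , σ≢τ)

⊏⇒nonempty-suffix : ∀ {σ τ} → σ ⊏ τ → ∃[ c ] ∃[ x ] (σ ++ c ∷ x ≡ τ)
⊏⇒nonempty-suffix {σ} (([] , σ++[]≡τ) , σ≢τ) =
  ⊥-elim (σ≢τ (trans (sym (List.++-identityʳ σ)) σ++[]≡τ))
⊏⇒nonempty-suffix ((c ∷ x , eq) , _) = c , x , eq

⊏-length : ∀ {σ τ} → σ ⊏ τ → length σ < length τ
⊏-length {σ} σ⊏τ with ⊏⇒nonempty-suffix σ⊏τ
... | c , x , refl =
  subst (length σ <_) (sym (List.length-++ σ)) (ℕ.m<m+n (length σ) (s≤s z≤n))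

⊏⇒⋣ : ∀ {σ τ} → σ ⊏ τ → ¬ (τ ⊑ σ)
⊏⇒⋣ σ⊏τ τ⊑σ = ℕ.<⇒≱ (⊏-length σ⊏τ) (⊑-length τ⊑σ)

⊏-child : ∀ {σ τ ρ} k → σ ⊏ τ → τ ⊑ ρ → (σ *ˢ k) ⊑ ρ → (σ *ˢ k) ⊑ τ
⊏-child {σ} k σ⊏τ τ⊑ρ σk⊑ρ with ⊏⇒nonempty-suffix σ⊏τ | τ⊑ρ | σk⊑ρ
... | c , x , refl | y , refl | z , eq =
  x , trans (List.++-assoc σ [ k ] x) (cong (λ d → σ ++ d ∷ x) k≡c)
  where
  same-suffix : σ ++ k ∷ z ≡ σ ++ (c ∷ x) ++ y
  same-suffix = trans (sym (List.++-assoc σ [ k ] z)) (trans eq (List.++-assoc σ (c ∷ x) y))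
  k≡c : k ≡ c
  k≡c = List.∷-injectiveˡ (List.++-cancelˡ σ (k ∷ z) ((c ∷ x) ++ y) same-suffix)

length≤sum : ∀ {ρ} {T : List Str} → ρ ∈ T → length ρ ≤ sum (map length T)
length≤sum (here refl) = ℕ.m≤m+n _ _
length≤sum {T = τ ∷ _} (there ρ∈T) = ℕ.≤-trans (length≤sum ρ∈T) (ℕ.m≤n+m _ (length τ))

record Monochromatic {N : ℕ} (p : Fin N → Bool) (b : Bool) (k : ℕ) : Set where
  field
    index : Fin k → Fin N
    injective : Injective _≡_ _≡_ index
    coloured : ∀ i → p (index i) ≡ b

open Monochromatic

shiftᴹ : ∀ {N} {p : Fin (suc N) → Bool} {b k} → Monochromatic (p ∘ F.suc) b k → Monochromatic p b k
shiftᴹ M = record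
  { index = F.suc ∘ index M
  ; injective = injective M ∘ suc-injective
  ; coloured = coloured M }

consᴹ : ∀ {N} {p : Fin (suc N) → Bool} {b k} →
  p F.zero ≡ b → Monochromatic (p ∘ F.suc) b k → Monochromatic p b (suc k)
consᴹ p₀ M = record
  { index = F.lift 1 (index M)
  ; injective = lift-injective (index M) (injective M) 1
  ; coloured = λ { F.zero → p₀ ; (F.suc i) → coloured M i } }

shrinkᴹ : ∀ {N} {p : Fin N → Bool} {b k l} → l ≤ k → Monochromatic p b k → Monochromatic p b l
shrinkᴹ l≤k M = record
  { index = index M ∘ (λ i → F.inject≤ i l≤k)
  ; injective = λ eq → inject≤-injective l≤k l≤k _ _ (injective M eq)
  ; coloured = λ i → coloured M _ }

colourClasses : ∀ N (p : Fin N → Bool) →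
  ∃[ t ] ∃[ u ] (t + u ≡ N × Monochromatic p true t × Monochromatic p false u)
colourClasses zero p = 0 , 0 , refl , empty , empty
  where
  empty : ∀ {b} → Monochromatic p b 0
  empty = record { index = λ () ; injective = λ { {()} } ; coloured = λ () }
colourClasses (suc N) p with colourClasses N (p ∘ F.suc) | p F.zero in p₀
... | t , u , t+u≡N , Tr , Fa | true = suc t , u , cong suc t+u≡N , consᴹ p₀ Tr , shiftᴹ Fa
... | t , u , t+u≡N , Tr , Fa | false =
  t , suc u , trans (ℕ.+-suc t u) (cong suc t+u≡N) , shiftᴹ Tr , consᴹ p₀ Fa

pigeonhole : ∀ m (p : Fin (m + m) → Bool) → ∃[ b ] Monochromatic p b m
pigeonhole m p with colourClasses (m + m) p
... | t , u , t+u≡m+m , Tr , Fa with m ℕ.≤? t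
...   | yes m≤t = true , shrinkᴹ m≤t Tr
...   | no m≰t = false , shrinkᴹ m≤u Fa
  where
  m≤u : m ≤ u
  m≤u = ℕ.+-cancelˡ-≤ m m u
          (subst (_≤ m + u) t+u≡m+m (ℕ.+-monoˡ-≤ u (ℕ.<⇒≤ (ℕ.≰⇒> m≰t))))

ManySuccs-mono : ∀ {a b T τ} → b ≤ a → ManySuccs a T τ → ManySuccs b T τ
ManySuccs-mono b≤a (f , f-inj , succs) =
  f ∘ (λ j → F.inject≤ j b≤a) ,
  (λ eq → inject≤-injective b≤a b≤a _ _ (f-inj eq)) ,
  (λ j → succs _)

Good-mono : ∀ {a b T σ} → b ≤ a → Good a T σ → Good b T σ
Good-mono b≤a (nonempty , above , branching) =
  nonempty , above , λ τ σ⊑τ ext → ManySuccs-mono b≤a (branching τ σ⊑τ ext)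

module TwoColours (m : ℕ) (m≥1 : 1 ≤ m) (T : List Str) (α : Str)
  (branching : ∀ τ → α ⊑ τ → (∃[ ρ ] (ρ ∈ T × τ ⊏ ρ)) → ManySuccs (m + m) T τ)
  (A B : Str → Set) (colour : ∀ τ → τ ∈ T → A τ ⊎ B τ) where

  SuccsIn : (Str → Set) → Str → Set
  SuccsIn D τ =
    Σ (Fin m → ℕ) λ f → Injective _≡_ _≡_ f × (∀ j → ∃[ ρ ] (D ρ × (τ *ˢ f j) ⊑ ρ))

  GoodSet : (C D : Str → Set) → Str → Set
  GoodSet C D σ =
    (∃[ x ] D x) × (∀ x → D x → C x) ×
    (∀ τ → σ ⊑ τ → (∃[ ρ ] (D ρ × τ ⊏ ρ)) → SuccsIn D τ)

  record MonoSubtree (σ : Str) : Set₁ where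
    field
      D : Str → Set
      D? : ∀ x → Dec (D x)
      D⊆T : ∀ x → D x → x ∈ T
      above : ∀ x → D x → σ ⊑ x
      good : GoodSet A D σ ⊎ GoodSet B D σ

  open MonoSubtree public

  singleton-good : ∀ C σ → C σ → GoodSet C (_≡ σ) σ
  singleton-good C σ cσ =
    (σ , refl) , (λ { x refl → cσ }) ,
    λ { τ σ⊑τ (ρ , refl , τ⊏σ) → ⊥-elim (⊏⇒⋣ τ⊏σ σ⊑τ) }

  leaf : ∀ σ → σ ∈ T → MonoSubtree σ
  leaf σ σ∈T = record
    { D = _≡ σ ; D? = _≟ˢ σ
    ; D⊆T = λ { x refl → σ∈T } ; above = λ { x refl → ⊑-refl σ }
    ; good = singleton-good-⊎ (colour σ σ∈T) }
    where
    singleton-good-⊎ : A σ ⊎ B σ → GoodSet A (_≡ σ) σ ⊎ GoodSet B (_≡ σ) σ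
    singleton-good-⊎ (inj₁ a) = inj₁ (singleton-good A σ a)
    singleton-good-⊎ (inj₂ b) = inj₂ (singleton-good B σ b)

  -- Below σ the
  -- union branches through the children k j; further up, a node τ lies above
  -- a single child, whose part of the union supplies τ's successors.
  glue : ∀ σ C (E : Fin m → Str → Set) (k : Fin m → ℕ) → Injective _≡_ _≡_ k →
    (∀ j x → E j x → (σ *ˢ k j) ⊑ x) → (∀ j → GoodSet C (E j) (σ *ˢ k j)) →
    GoodSet C (λ x → ∃[ j ] E j x) σ
  glue σ C E k k-inj E-above E-good = nonempty , coloured-C , succs
    where
    nonempty : ∃[ x ] ∃[ j ] E j x
    nonempty with proj₁ (E-good (F.fromℕ< m≥1))
    ... | x , e = x , F.fromℕ< m≥1 , e
    coloured-C : ∀ x → (∃[ j ] E j x) → C x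
    coloured-C x (j , e) = proj₁ (proj₂ (E-good j)) x e
    succs : ∀ τ → σ ⊑ τ → (∃[ ρ ] ((∃[ j ] E j ρ) × τ ⊏ ρ)) → SuccsIn (λ x → ∃[ j ] E j x) τ
    succs τ σ⊑τ (ρ , (j , e) , τ⊏ρ) with ⊑⇒≡⊎⊏ σ⊑τ
    ... | inj₁ refl =
      k , k-inj , λ j' → let (x , e') = proj₁ (E-good j') in x , (j' , e') , E-above j' x e'
    ... | inj₂ σ⊏τ
      with proj₂ (proj₂ (E-good j)) τ (⊏-child (k j) σ⊏τ (proj₁ τ⊏ρ) (E-above j ρ e)) (ρ , e , τ⊏ρ)
    ...   | f , f-inj , w = f , f-inj , λ j' → let (x , e' , p) = w j' in x , (j , e') , p

  isA : ∀ {D σ} → GoodSet A D σ ⊎ GoodSet B D σ → Bool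
  isA (inj₁ _) = true
  isA (inj₂ _) = false

  fromA : ∀ {D σ} (g : GoodSet A D σ ⊎ GoodSet B D σ) → isA g ≡ true → GoodSet A D σ
  fromA (inj₁ g) _ = g

  fromB : ∀ {D σ} (g : GoodSet A D σ ⊎ GoodSet B D σ) → isA g ≡ false → GoodSet B D σ
  fromB (inj₂ g) _ = g

  -- An inner node: among the 2m children leading into T, m carry subtrees of
  -- the same colour (pigeonhole), and these glue to a subtree above σ.
  node : ∀ σ (succs : ManySuccs (m + m) T σ) →
    (∀ j → MonoSubtree (σ *ˢ proj₁ succs j)) → MonoSubtree σ
  node σ (f , f-inj , _) sub with pigeonhole m (isA ∘ good ∘ sub)
  ... | b , M = record
    { D = U
    ; D? = λ x → any? (λ i → D? (chosen i) x)
    ; D⊆T = λ { x (i , e) → D⊆T (chosen i) x e }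
    ; above = λ { x (i , e) → ⊑-trans (⊑-child σ _) (above (chosen i) x e) }
    ; good = glued b (coloured M) }
    where
    chosen : ∀ i → MonoSubtree (σ *ˢ f (index M i))
    chosen = sub ∘ index M
    U : Str → Set
    U x = ∃[ i ] D (chosen i) x
    glue-chosen : ∀ C → (∀ i → GoodSet C (D (chosen i)) (σ *ˢ f (index M i))) → GoodSet C U σ
    glue-chosen C = glue σ C (D ∘ chosen) (f ∘ index M) (injective M ∘ f-inj) (above ∘ chosen)
    glued : ∀ b → (∀ i → isA (good (chosen i)) ≡ b) → GoodSet A U σ ⊎ GoodSet B U σ
    glued true same = inj₁ (glue-chosen A (λ i → fromA (good (chosen i)) (same i)))
    glued false same = inj₂ (glue-chosen B (λ i → fromB (good (chosen i)) (same i)))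

  HeightBound : Str → ℕ → Set
  HeightBound σ h = ∀ ρ → ρ ∈ T → σ ⊑ ρ → length ρ ≤ length σ + h

  child-height : ∀ {σ h} k → HeightBound σ (suc h) → HeightBound (σ *ˢ k) h
  child-height {σ} {h} k bound ρ ρ∈T σk⊑ρ =
    subst (length ρ ≤_) length-step (bound ρ ρ∈T (⊑-trans (⊑-child σ k) σk⊑ρ))
    where
    length-step : length σ + suc h ≡ length (σ *ˢ k) + h
    length-step = trans (sym (ℕ.+-assoc (length σ) 1 h)) (cong (_+ h) (sym (List.length-++ σ)))

  build : ∀ h σ → α ⊑ σ → HeightBound σ h → IsInitSeg T σ → MonoSubtree σ
  build h σ α⊑σ bound (ρ , ρ∈T , σ⊑ρ) with ⊑⇒≡⊎⊏ σ⊑ρ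
  ... | inj₁ refl = leaf σ ρ∈T
  build zero σ α⊑σ bound (ρ , ρ∈T , σ⊑ρ) | inj₂ σ⊏ρ =
    ⊥-elim (ℕ.<⇒≱ (⊏-length σ⊏ρ)
      (subst (length ρ ≤_) (ℕ.+-identityʳ (length σ)) (bound ρ ρ∈T σ⊑ρ)))
  build (suc h) σ α⊑σ bound (ρ , ρ∈T , σ⊑ρ) | inj₂ σ⊏ρ = node σ succs λ j →
    build h _ (⊑-trans α⊑σ (⊑-child σ _)) (child-height _ bound) (proj₂ (proj₂ succs) j)
    where
    succs : ManySuccs (m + m) T σ
    succs = branching σ α⊑σ (ρ , ρ∈T , σ⊏ρ)

  toGoodFor : ∀ C (S : MonoSubtree α) → GoodSet C (D S) α → GoodFor m (filter (D? S) T) α C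
  toGoodFor C S ((x , Dx) , in-C , succs) =
    ((x , ∈S Dx) , (λ τ τ∈ → above S τ (D-of τ∈)) , branching-S) , λ τ τ∈ → in-C τ (D-of τ∈)
    where
    D-of : ∀ {τ} → τ ∈ filter (D? S) T → D S τ
    D-of τ∈ = proj₂ (∈-filter⁻ (D? S) {xs = T} τ∈)
    ∈S : ∀ {τ} → D S τ → τ ∈ filter (D? S) T
    ∈S {τ} Dτ = ∈-filter⁺ (D? S) (D⊆T S τ Dτ) Dτ
    branching-S : ∀ τ → α ⊑ τ → (∃[ ρ ] (ρ ∈ filter (D? S) T × τ ⊏ ρ)) →
      ManySuccs m (filter (D? S) T) τ
    branching-S τ α⊑τ (ρ , ρ∈ , τ⊏ρ) with succs τ α⊑τ (ρ , D-of ρ∈ , τ⊏ρ)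
    ... | f , f-inj , w = f , f-inj , λ j → let (y , Dy , p) = w j in y , ∈S Dy , p

twoColours : ∀ m → 1 ≤ m → (T : List Str) → IsTree T → (α : Str) → Good (m + m) T α →
  (A B : Str → Set) → (∀ τ → τ ∈ T → A τ ⊎ B τ) →
  ∃[ S ] (IsTree S × (∀ τ → τ ∈ S → τ ∈ T) × (GoodFor m S α A ⊎ GoodFor m S α B))
twoColours m m≥1 T T-tree α ((ρ , ρ∈T) , above-α , branching) A B colour =
  filter (D? S) T , filter⁺ (D? S) T-tree ,
  (λ τ τ∈ → proj₁ (∈-filter⁻ (D? S) {xs = T} τ∈)) , goodFor (good S)
  where
  open TwoColours m m≥1 T α branching A B colour
  S : MonoSubtree α
  S = build (sum (map length T)) α (⊑-refl α)
    (λ ρ' ρ'∈T _ → ℕ.≤-trans (length≤sum ρ'∈T) (ℕ.m≤n+m _ (length α)))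
    (ρ , ρ∈T , above-α ρ ρ∈T)
  goodFor : GoodSet A (D S) α ⊎ GoodSet B (D S) α →
    GoodFor m (filter (D? S) T) α A ⊎ GoodFor m (filter (D? S) T) α B
  goodFor (inj₁ g) = inj₁ (toGoodFor A S g)
  goodFor (inj₂ g) = inj₂ (toGoodFor B S g)

2^a*n-positive : ∀ a n → 1 ≤ n → 1 ≤ 2 ^ a * n
2^a*n-positive a n n≥1 = ℕ.*-mono-≤ (ℕ.m^n>0 2 a) n≥1

n≤2^a*n : ∀ a n → n ≤ 2 ^ a * n
n≤2^a*n a n = ℕ.m≤n*m n (2 ^ a) {{ℕ.m^n≢0 2 a}}

2^[1+a]*n≡double : ∀ a n → 2 ^ suc a * n ≡ 2 ^ a * n + 2 ^ a * n
2^[1+a]*n≡double a n =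
  trans (ℕ.*-assoc 2 (2 ^ a) n) (cong (2 ^ a * n +_) (ℕ.+-identityʳ (2 ^ a * n)))

firstOrRest : ∀ {a} {P : Fin (suc a) → Str → Set} {τ} →
  ∃[ i ] P i τ → P F.zero τ ⊎ ∃[ i ] P (F.suc i) τ
firstOrRest (F.zero , p) = inj₁ p
firstOrRest (F.suc i , p) = inj₂ (i , p)

-- With a + 1 colours and a 2^a·n-good tree: split off the first colour with
-- twoColours; either it wins, or the rest get a 2^(a-1)·n-good subtree.
manyColours : ∀ a n → 1 ≤ n →
  (T : List Str) → IsTree T → (α : Str) → Good (2 ^ a * n) T α →
  (P : Fin (suc a) → Str → Set) → (∀ τ → τ ∈ T → ∃[ i ] P i τ) →
  ∃[ i ] ∃[ S ] (IsTree S × (∀ τ → τ ∈ S → τ ∈ T) × GoodFor n S α (P i))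
manyColours zero n _ T T-tree α good P colour =
  F.zero , T , T-tree , (λ τ τ∈T → τ∈T) , Good-mono (n≤2^a*n 0 n) good , only
  where
  only : ∀ τ → τ ∈ T → P F.zero τ
  only τ τ∈T with firstOrRest {P = P} (colour τ τ∈T)
  ... | inj₁ p = p
manyColours (suc a) n n≥1 T T-tree α good P colour
  with twoColours (2 ^ a * n) (2^a*n-positive a n n≥1) T T-tree α
         (subst (λ b → Good b T α) (2^[1+a]*n≡double a n) good)
         (P F.zero) (λ τ → ∃[ i ] P (F.suc i) τ) (λ τ → firstOrRest {P = P} ∘ colour τ)
... | S , S-tree , S⊆T , inj₁ (S-good , S-first) =
  F.zero , S , S-tree , S⊆T , Good-mono (n≤2^a*n a n) S-good , S-first
... | S , S-tree , S⊆T , inj₂ (S-good , S-rest)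
  with manyColours a n n≥1 S S-tree α S-good (P ∘ F.suc) S-rest
...   | i , S' , S'-tree , S'⊆S , S'-good =
  F.suc i , S' , S'-tree , (λ τ → S⊆T τ ∘ S'⊆S τ) , S'-good

lemma2p6 : (a n : ℕ) → 1 ≤ a → 1 ≤ n →
    (T : List Str) → IsTree T → (α : Str) → Good (2 ^ (a ∸ 1) * n) T α →
    (P : Fin a → Str → Set) → (∀ τ → τ ∈ T → ∃[ i ] P i τ) →
    ∃[ i ] ∃[ S ] (IsTree S × (∀ τ → τ ∈ S → τ ∈ T) × GoodFor n S α (P i))
lemma2p6 (suc a) n _ n≥1 = manyColours a n n≥1
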